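{- A finite simple graph $G$ satisfies $\mathrm{diadem}(G)=\mathrm{corona}(G)\cap L(G)$ if and only if $\mathrm{corona}(G)\cap\partial_L(G)=\emptyset$.
   Context: For $X\subseteq V(G)$, $N(X)$ is the union of neighborhoods of the vertices of $X$. $\mathrm{corona}(G)$ is the union of all maximum independent sets of $G$. An independent set $I$ is critical if $|I|-|N(I)|\ge|J|-|N(J)|$ for every independent set $J$; a maximum critical independent set is a critical independent set of maximum cardinality among critical independent sets; $\mathrm{diadem}(G)$ is the union of all critical independent sets. $L(G)$ denotes the set $J\cup N(J)$ for any maximum critical independent set $J$ of $G$ (this set does not depend on the choice of $J$); $L^c(G)=V(G)-L(G)$ and $\partial_L(G)=\{v\in L(G):N(v)\cap L^c(G)\neq\emptyset\}$. -}

module Defs where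

open import Data.Nat using (ℕ; _≤_)
open import Data.Bool using (Bool; true; false; T)
open import Data.Fin using (Fin)
open import Data.Fin.Subset using (Subset; _∈_; _∉_; ∣_∣)
open import Data.Fin.Subset.Properties using (_∈?_)
open import Data.Fin.Properties using (any?)
open import Data.Vec using (tabulate)
open import Data.Integer using (ℤ; +_; _-_) renaming (_≤_ to _≤ℤ_)
open import Data.Product using (_×_; ∃; ∃-syntax)
open import Data.Sum using (_⊎_)
open import Relation.Nullary using (¬_)
open import Relation.Nullary.Decidable using (⌊_⌋; _×-dec_; T?)
open import Relation.Binary.PropositionalEquality using (_≡_)

record Graph (n : ℕ) : Set where
  field
    adj   : Fin n → Fin n → Bool
    sym   : ∀ u v → adj u v ≡ adj v u
    irref : ∀ v → adj v v ≡ false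

module _ {n : ℕ} (G : Graph n) where
  open Graph G

  Adj : Fin n → Fin n → Set
  Adj u v = T (adj u v)

  Independent : Subset n → Set
  Independent S = ∀ u v → u ∈ S → v ∈ S → ¬ Adj u v

  N : Subset n → Subset n
  N S = tabulate (λ v → ⌊ any? (λ u → (u ∈? S) ×-dec T? (adj u v)) ⌋)

  defect : Subset n → ℤ
  defect S = + ∣ S ∣ - + ∣ N S ∣

  MaximumIndependent : Subset n → Set
  MaximumIndependent S = Independent S × (∀ J → Independent J → ∣ J ∣ ≤ ∣ S ∣)

  Critical : Subset n → Set
  Critical I = Independent I × (∀ J → Independent J → defect J ≤ℤ defect I)

  MaximumCritical : Subset n → Set
  MaximumCritical I = Critical I × (∀ J → Critical J → ∣ J ∣ ≤ ∣ I ∣)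

  InCorona : Fin n → Set
  InCorona v = ∃[ S ] (MaximumIndependent S × v ∈ S)

  InDiadem : Fin n → Set
  InDiadem v = ∃[ I ] (Critical I × v ∈ I)

  -- L = J ∪ N(J) for a given (maximum critical independent) set J
  InL : Subset n → Fin n → Set
  InL J v = v ∈ J ⊎ v ∈ N J

  InBoundaryL : Subset n → Fin n → Set
  InBoundaryL J v = InL J v × ∃[ u ] (Adj v u × ¬ InL J u)

{-# OPTIONS --safe #-}
-- Let d(S) = |S| − |N(S)|, J a maximum critical independent set and L = J ∪ N(J). The defect d is
-- supermodular, and replacing any S by its core S − N(S) (an independent set) does not decrease it, so
-- d(J) bounds d on all subsets and sets reaching d(J) are closed under union. For a critical I the core
-- of I ∪ J is therefore critical; with J it forms a critical set containing J, so by maximality of |J|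
-- it lies in J, and comparing defects once more gives I ∪ N(I) ⊆ L. A counting argument also puts every
-- critical I inside a maximum independent set S (|S ∩ N(I)| ≤ |I − S|, so I ∪ (S − N(I)) is no smaller
-- than S). Hence diadem ⊆ corona ∩ L, and a corona vertex of ∂L, having a neighbour outside L ⊇ N(I),
-- can lie in no critical I. Conversely, if corona ∩ ∂L = ∅ and S is maximum independent, then
-- N(S ∩ L) ⊆ L, and comparing S with the independent set J ∪ (S − L) yields |J| ≤ |S ∩ L| and
-- |N(S ∩ L)| ≤ |N(J)|, so S ∩ L is critical.
module Submission where

open import Defs
open import Data.Nat using (ℕ; zero; suc; _+_; _≤_; _<_; z≤n; _≤?_)
import Data.Nat.Properties as ℕ
open import Data.Bool using (T)
open import Data.Bool.Properties using (T-≡)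
open import Data.Fin using (Fin)
open import Data.Fin.Subset using (Subset; inside; outside; _∈_; _∉_; _⊆_; _⊂_; ⊥; _∪_; _∩_; _─_; ∣_∣)
open import Data.Fin.Subset.Properties
  using (_∈?_; p⊆q⇒∣p∣≤∣q∣; p⊂q⇒∣p∣<∣q∣; ∉⊥; ∣⊥∣≡0; x∈p∪q⁺; x∈p∪q⁻; x∈p∩q⁺; x∈p∩q⁻; p⊆p∪q; q⊆p∪q;
         p∩q⊆p; p∩q⊆q; x∈p∧x∉q⇒x∈p─q; p─q⊆p; x∈p⇒∣p-x∣<∣p∣; ∣p∣≤n; anySubset?)
-- The prefix +_ of ℤ would make expressions like ∣ p ∣ + suc ∣ q ∣ ambiguous, hence pos.
open import Data.Integer using (-_; _-_; +≤+) renaming (+_ to pos; _+_ to _+ℤ_; _≤_ to _≤ℤ_)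
import Data.Integer.Properties as ℤ
open import Data.Integer.Tactic.RingSolver using (solve-∀)
import Data.Nat.Tactic.RingSolver as ℕ-Solver
open import Data.Vec using ([]; _∷_; there)
open import Data.Vec.Properties using ([]=⇒lookup; lookup⇒[]=; lookup∘tabulate)
open import Data.Fin.Properties using (all?)
open import Function.Bundles using (_⇔_; mk⇔; Equivalence)
open import Relation.Nullary using (¬_; Dec; yes; no)
open import Relation.Nullary.Decidable using (toWitness; fromWitness; _→-dec_; _×-dec_; ¬?; T?)
open import Relation.Unary using (Decidable)
open import Data.Product using (_×_; _,_; proj₁; proj₂; ∃-syntax)
open import Data.Sum using (inj₁; inj₂; [_,_]′)
open import Data.Empty using (⊥-elim)
open import Relation.Binary.PropositionalEquality using (_≡_; refl; cong; cong₂; sym; trans; subst; subst₂; module ≡-Reasoning)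

private variable
  n : ℕ

Disjoint : Subset n → Subset n → Set
Disjoint p q = ∀ {x} → x ∈ p → x ∉ q

x∈p─q⇒x∉q : ∀ {x : Fin n} {p q} → x ∈ p ─ q → x ∉ q
x∈p─q⇒x∉q {p = _ ∷ p} {inside ∷ q} (there x∈p─q) (there x∈q) = x∈p─q⇒x∉q x∈p─q x∈q
x∈p─q⇒x∉q {p = _ ∷ p} {outside ∷ q} (there x∈p─q) (there x∈q) = x∈p─q⇒x∉q x∈p─q x∈q

∣p∪q∣+∣p∩q∣≡∣p∣+∣q∣ : ∀ (p q : Subset n) → ∣ p ∪ q ∣ + ∣ p ∩ q ∣ ≡ ∣ p ∣ + ∣ q ∣
∣p∪q∣+∣p∩q∣≡∣p∣+∣q∣ [] [] = refl
∣p∪q∣+∣p∩q∣≡∣p∣+∣q∣ (inside ∷ p) (inside ∷ q) = cong suc (begin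
  ∣ p ∪ q ∣ + suc ∣ p ∩ q ∣  ≡⟨ ℕ.+-suc ∣ p ∪ q ∣ ∣ p ∩ q ∣ ⟩
  suc (∣ p ∪ q ∣ + ∣ p ∩ q ∣) ≡⟨ cong suc (∣p∪q∣+∣p∩q∣≡∣p∣+∣q∣ p q) ⟩
  suc (∣ p ∣ + ∣ q ∣)         ≡⟨ ℕ.+-suc ∣ p ∣ ∣ q ∣ ⟨
  ∣ p ∣ + suc ∣ q ∣           ∎)
  where open ≡-Reasoning
∣p∪q∣+∣p∩q∣≡∣p∣+∣q∣ (inside ∷ p) (outside ∷ q) = cong suc (∣p∪q∣+∣p∩q∣≡∣p∣+∣q∣ p q)
∣p∪q∣+∣p∩q∣≡∣p∣+∣q∣ (outside ∷ p) (inside ∷ q) =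
  trans (cong suc (∣p∪q∣+∣p∩q∣≡∣p∣+∣q∣ p q)) (sym (ℕ.+-suc ∣ p ∣ ∣ q ∣))
∣p∪q∣+∣p∩q∣≡∣p∣+∣q∣ (outside ∷ p) (outside ∷ q) = ∣p∪q∣+∣p∩q∣≡∣p∣+∣q∣ p q

∣p∣≡∣p∩q∣+∣p─q∣ : ∀ (p q : Subset n) → ∣ p ∣ ≡ ∣ p ∩ q ∣ + ∣ p ─ q ∣
∣p∣≡∣p∩q∣+∣p─q∣ [] [] = refl
∣p∣≡∣p∩q∣+∣p─q∣ (inside ∷ p) (inside ∷ q) = cong suc (∣p∣≡∣p∩q∣+∣p─q∣ p q)
∣p∣≡∣p∩q∣+∣p─q∣ (inside ∷ p) (outside ∷ q) =
  trans (cong suc (∣p∣≡∣p∩q∣+∣p─q∣ p q)) (sym (ℕ.+-suc ∣ p ∩ q ∣ ∣ p ─ q ∣))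
∣p∣≡∣p∩q∣+∣p─q∣ (outside ∷ p) (inside ∷ q) = ∣p∣≡∣p∩q∣+∣p─q∣ p q
∣p∣≡∣p∩q∣+∣p─q∣ (outside ∷ p) (outside ∷ q) = ∣p∣≡∣p∩q∣+∣p─q∣ p q

∣p∪q∣≤∣p∣+∣q∣ : ∀ (p q : Subset n) → ∣ p ∪ q ∣ ≤ ∣ p ∣ + ∣ q ∣
∣p∪q∣≤∣p∣+∣q∣ p q = ℕ.≤-trans (ℕ.m≤m+n ∣ p ∪ q ∣ ∣ p ∩ q ∣) (ℕ.≤-reflexive (∣p∪q∣+∣p∩q∣≡∣p∣+∣q∣ p q))

disjoint⇒∣p∣+∣q∣≤∣r∣ : ∀ {p q r : Subset n} → p ⊆ r → q ⊆ r → Disjoint p q → ∣ p ∣ + ∣ q ∣ ≤ ∣ r ∣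
disjoint⇒∣p∣+∣q∣≤∣r∣ {n} {p} {q} {r} p⊆r q⊆r p#q = begin
  ∣ p ∣ + ∣ q ∣          ≡⟨ ∣p∪q∣+∣p∩q∣≡∣p∣+∣q∣ p q ⟨
  ∣ p ∪ q ∣ + ∣ p ∩ q ∣  ≤⟨ ℕ.+-mono-≤ (p⊆q⇒∣p∣≤∣q∣ p∪q⊆r) ∣p∩q∣≤0 ⟩
  ∣ r ∣ + 0              ≡⟨ ℕ.+-identityʳ ∣ r ∣ ⟩
  ∣ r ∣                  ∎
  where
  open ℕ.≤-Reasoning
  p∪q⊆r : p ∪ q ⊆ r
  p∪q⊆r x∈p∪q = [ p⊆r , q⊆r ]′ (x∈p∪q⁻ p q x∈p∪q)
  p∩q⊆⊥ : p ∩ q ⊆ ⊥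
  p∩q⊆⊥ x∈p∩q = let x∈p , x∈q = x∈p∩q⁻ p q x∈p∩q in ⊥-elim (p#q x∈p x∈q)
  ∣p∩q∣≤0 : ∣ p ∩ q ∣ ≤ 0
  ∣p∩q∣≤0 = ℕ.≤-trans (p⊆q⇒∣p∣≤∣q∣ p∩q⊆⊥) (ℕ.≤-reflexive (∣⊥∣≡0 n))

x∈p⇒0<∣p∣ : ∀ {x : Fin n} {p} → x ∈ p → 0 < ∣ p ∣
x∈p⇒0<∣p∣ x∈p = ℕ.≤-<-trans z≤n (x∈p⇒∣p-x∣<∣p∣ x∈p)

∃-maximum : ∀ {P : Subset n → Set} → Decidable P → ∀ {p} → P p →
            ∃[ m ] (P m × ∀ q → P q → ∣ q ∣ ≤ ∣ m ∣)
∃-maximum {n} {P} P? {p} Pp = climb n p Pp (ℕ.m≤m+n n ∣ p ∣)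
  where
  climb : ∀ k p → P p → n ≤ k + ∣ p ∣ → ∃[ m ] (P m × ∀ q → P q → ∣ q ∣ ≤ ∣ m ∣)
  climb k p Pp n≤k+∣p∣ with anySubset? (λ q → P? q ×-dec (suc ∣ p ∣ ≤? ∣ q ∣))
  ... | no ∄larger = p , Pp , λ q Pq → ℕ.≮⇒≥ (λ ∣p∣<∣q∣ → ∄larger (q , Pq , ∣p∣<∣q∣))
  climb zero p _ n≤∣p∣ | yes (q , _ , ∣p∣<∣q∣) =
    ⊥-elim (ℕ.<⇒≱ ∣p∣<∣q∣ (ℕ.≤-trans (∣p∣≤n q) n≤∣p∣))
  climb (suc k) p _ n≤1+k+∣p∣ | yes (q , Pq , ∣p∣<∣q∣) = climb k q Pq (begin
    n               ≤⟨ n≤1+k+∣p∣ ⟩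
    suc k + ∣ p ∣   ≡⟨ ℕ.+-suc k ∣ p ∣ ⟨
    k + suc ∣ p ∣   ≤⟨ ℕ.+-monoʳ-≤ k ∣p∣<∣q∣ ⟩
    k + ∣ q ∣       ∎)
    where open ℕ.≤-Reasoning

+-cancelʳ-≤ : ∀ k {i j} → i +ℤ k ≤ℤ j +ℤ k → i ≤ℤ j
+-cancelʳ-≤ k {i} {j} i+k≤j+k = subst₂ _≤ℤ_ (+k-k i k) (+k-k j k) (ℤ.+-monoˡ-≤ (- k) i+k≤j+k)
  where
  +k-k : ∀ i k → i +ℤ k - k ≡ i
  +k-k = solve-∀

pos-minus-+ : ∀ m n o p → (pos m - pos n) +ℤ (pos o - pos p) ≡ pos (m + o) - pos (n + p)
pos-minus-+ m n o p = begin
  (pos m - pos n) +ℤ (pos o - pos p)       ≡⟨ interchange (pos m) (pos n) (pos o) (pos p) ⟩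
  (pos m +ℤ pos o) - (pos n +ℤ pos p)      ≡⟨ cong₂ _-_ (ℤ.pos-+ m o) (ℤ.pos-+ n p) ⟨
  pos (m + o) - pos (n + p)                ∎
  where
  open ≡-Reasoning
  interchange : ∀ i j k l → (i - j) +ℤ (k - l) ≡ (i +ℤ k) - (j +ℤ l)
  interchange = solve-∀

pos-minus-≤⇔ : ∀ {m n o p} → (pos m - pos n ≤ℤ pos o - pos p) ⇔ (m + p ≤ o + n)
pos-minus-≤⇔ {m} {n} {o} {p} = mk⇔
  (λ le → ℤ.drop‿+≤+ (subst₂ _≤ℤ_ m-n+k o-p+k (ℤ.+-monoˡ-≤ k le)))
  (λ le → +-cancelʳ-≤ k (subst₂ _≤ℤ_ (sym m-n+k) (sym o-p+k) (+≤+ le)))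
  where
  k = pos n +ℤ pos p
  cancelˡ : ∀ i j l → (i - j) +ℤ (j +ℤ l) ≡ i +ℤ l
  cancelˡ = solve-∀
  cancelʳ : ∀ i j l → (i - l) +ℤ (j +ℤ l) ≡ i +ℤ j
  cancelʳ = solve-∀
  m-n+k : (pos m - pos n) +ℤ k ≡ pos (m + p)
  m-n+k = trans (cancelˡ (pos m) (pos n) (pos p)) (sym (ℤ.pos-+ m p))
  o-p+k : (pos o - pos p) +ℤ k ≡ pos (o + n)
  o-p+k = trans (cancelʳ (pos o) (pos n) (pos p)) (sym (ℤ.pos-+ o n))

minus-mono-≤ : ∀ {i j k l} → i ≤ℤ j → l ≤ℤ k → i - k ≤ℤ j - l
minus-mono-≤ i≤j l≤k = ℤ.+-mono-≤ i≤j (ℤ.neg-mono-≤ l≤k)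

module _ (G : Graph n) where

  Adj-sym : ∀ {u v} → Adj G u v → Adj G v u
  Adj-sym {u} {v} = subst T (Graph.sym G u v)

  ∈N⁺ : ∀ {S u v} → u ∈ S → Adj G u v → v ∈ N G S
  ∈N⁺ {S} {u} {v} u∈S uv = lookup⇒[]= v (N G S)
    (trans (lookup∘tabulate _ v) (Equivalence.to T-≡ (fromWitness (u , u∈S , uv))))

  ∈N⁻ : ∀ {S v} → v ∈ N G S → ∃[ u ] (u ∈ S × Adj G u v)
  ∈N⁻ {S} {v} v∈NS =
    toWitness (Equivalence.from T-≡ (trans (sym (lookup∘tabulate _ v)) ([]=⇒lookup v∈NS)))

  N-mono : ∀ {p q} → p ⊆ q → N G p ⊆ N G q
  N-mono p⊆q x∈Np = let u , u∈p , ux = ∈N⁻ x∈Np in ∈N⁺ (p⊆q u∈p) ux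

  N-∪ : ∀ {p q} → N G (p ∪ q) ⊆ N G p ∪ N G q
  N-∪ {p} {q} x∈N[p∪q] with ∈N⁻ x∈N[p∪q]
  ... | u , u∈p∪q , ux with x∈p∪q⁻ p q u∈p∪q
  ...   | inj₁ u∈p = p⊆p∪q (N G q) (∈N⁺ u∈p ux)
  ...   | inj₂ u∈q = q⊆p∪q (N G p) (N G q) (∈N⁺ u∈q ux)

  Independent? : ∀ S → Dec (Independent G S)
  Independent? S = all? λ u → all? λ v →
    (u ∈? S) →-dec (v ∈? S) →-dec ¬? (T? (Graph.adj G u v))

  Independent-⊆ : ∀ {p q} → p ⊆ q → Independent G q → Independent G p
  Independent-⊆ p⊆q indq u v u∈p v∈p = indq u v (p⊆q u∈p) (p⊆q v∈p)

  Independent⇒Disjoint-N : ∀ {S} → Independent G S → Disjoint S (N G S)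
  Independent⇒Disjoint-N indS x∈S x∈NS = let u , u∈S , ux = ∈N⁻ x∈NS in indS u _ u∈S x∈S ux

  Independent-∪ : ∀ {p q} → Independent G p → Independent G q → Disjoint (N G p) q →
                  Independent G (p ∪ q)
  Independent-∪ {p} {q} indp indq Np#q u v u∈p∪q v∈p∪q uv with x∈p∪q⁻ p q u∈p∪q | x∈p∪q⁻ p q v∈p∪q
  ... | inj₁ u∈p | inj₁ v∈p = indp u v u∈p v∈p uv
  ... | inj₁ u∈p | inj₂ v∈q = Np#q (∈N⁺ u∈p uv) v∈q
  ... | inj₂ u∈q | inj₁ v∈p = Np#q (∈N⁺ v∈p (Adj-sym uv)) u∈q
  ... | inj₂ u∈q | inj₂ v∈q = indq u v u∈q v∈q uv

  defect-≤⇔ : ∀ {p q} → (defect G p ≤ℤ defect G q) ⇔ (∣ p ∣ + ∣ N G q ∣ ≤ ∣ q ∣ + ∣ N G p ∣)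
  defect-≤⇔ {p} {q} = pos-minus-≤⇔ {∣ p ∣} {∣ N G p ∣} {∣ q ∣} {∣ N G q ∣}

  N-∩ : ∀ {p q} → N G (p ∩ q) ⊆ N G p ∩ N G q
  N-∩ {p} {q} x∈N[p∩q] = x∈p∩q⁺ (N-mono (p∩q⊆p p q) x∈N[p∩q] , N-mono (p∩q⊆q p q) x∈N[p∩q])

  ∣N[p∪q]∣+∣N[p∩q]∣≤∣N[p]∣+∣N[q]∣ : ∀ p q → ∣ N G (p ∪ q) ∣ + ∣ N G (p ∩ q) ∣ ≤ ∣ N G p ∣ + ∣ N G q ∣
  ∣N[p∪q]∣+∣N[p∩q]∣≤∣N[p]∣+∣N[q]∣ p q = begin
    ∣ N G (p ∪ q) ∣ + ∣ N G (p ∩ q) ∣      ≤⟨ ℕ.+-mono-≤ (p⊆q⇒∣p∣≤∣q∣ N-∪) (p⊆q⇒∣p∣≤∣q∣ N-∩) ⟩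
    ∣ N G p ∪ N G q ∣ + ∣ N G p ∩ N G q ∣  ≡⟨ ∣p∪q∣+∣p∩q∣≡∣p∣+∣q∣ (N G p) (N G q) ⟩
    ∣ N G p ∣ + ∣ N G q ∣                  ∎
    where open ℕ.≤-Reasoning

  defect-+ : ∀ p q → defect G p +ℤ defect G q ≡ pos (∣ p ∣ + ∣ q ∣) - pos (∣ N G p ∣ + ∣ N G q ∣)
  defect-+ p q = pos-minus-+ (∣ p ∣) (∣ N G p ∣) (∣ q ∣) (∣ N G q ∣)

  defect-supermodular : ∀ p q → defect G p +ℤ defect G q ≤ℤ defect G (p ∪ q) +ℤ defect G (p ∩ q)
  defect-supermodular p q = begin
    defect G p +ℤ defect G q                                             ≡⟨ defect-+ p q ⟩
    pos (∣ p ∣ + ∣ q ∣) - pos (∣ N G p ∣ + ∣ N G q ∣)                      ≤⟨ minus-mono-≤ ∣p∣+∣q∣≤ ∣N∣≤ ⟩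
    pos (∣ p ∪ q ∣ + ∣ p ∩ q ∣) - pos (∣ N G (p ∪ q) ∣ + ∣ N G (p ∩ q) ∣)  ≡⟨ defect-+ (p ∪ q) (p ∩ q) ⟨
    defect G (p ∪ q) +ℤ defect G (p ∩ q)                                 ∎
    where
    open ℤ.≤-Reasoning
    ∣p∣+∣q∣≤ = +≤+ (ℕ.≤-reflexive (sym (∣p∪q∣+∣p∩q∣≡∣p∣+∣q∣ p q)))
    ∣N∣≤ = +≤+ (∣N[p∪q]∣+∣N[p∩q]∣≤∣N[p]∣+∣N[q]∣ p q)

  core : Subset n → Subset n
  core S = S ─ N G S

  core-independent : ∀ S → Independent G (core S)
  core-independent S u v u∈C v∈C uv = x∈p─q⇒x∉q v∈C (∈N⁺ (p─q⊆p S (N G S) u∈C) uv)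

  N[core]#S : ∀ S → Disjoint (N G (core S)) S
  N[core]#S S x∈NC x∈S =
    let c , c∈C , cx = ∈N⁻ x∈NC in x∈p─q⇒x∉q c∈C (∈N⁺ x∈S (Adj-sym cx))

  uncovered : Subset n → Subset n
  uncovered S = N G S ─ N G (core S) ─ S

  -- The core drops S ∩ N(S) from S, but N(S) − N(core S) contains S ∩ N(S) and all of uncovered S.
  core-gain : ∀ S → ∣ S ∣ + ∣ N G (core S) ∣ + ∣ uncovered S ∣ ≤ ∣ core S ∣ + ∣ N G S ∣
  core-gain S = begin
    ∣ S ∣ + ∣ N G C ∣ + ∣ R ─ S ∣              ≡⟨ cong (λ s → s + ∣ N G C ∣ + ∣ R ─ S ∣) (∣p∣≡∣p∩q∣+∣p─q∣ S (N G S)) ⟩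
    ∣ K ∣ + ∣ C ∣ + ∣ N G C ∣ + ∣ R ─ S ∣      ≡⟨ rearrange ∣ K ∣ _ _ _ ⟩
    ∣ C ∣ + (∣ N G C ∣ + (∣ K ∣ + ∣ R ─ S ∣))  ≤⟨ ℕ.+-monoʳ-≤ ∣ C ∣ (ℕ.+-monoʳ-≤ ∣ N G C ∣ ∣K∣+∣R─S∣≤∣R∣) ⟩
    ∣ C ∣ + (∣ N G C ∣ + ∣ R ∣)                ≤⟨ ℕ.+-monoʳ-≤ ∣ C ∣ ∣NC∣+∣R∣≤∣NS∣ ⟩
    ∣ C ∣ + ∣ N G S ∣                          ∎
    where
    open ℕ.≤-Reasoning
    C = core S
    K = S ∩ N G S
    R = N G S ─ N G C
    rearrange : ∀ k c m e → k + c + m + e ≡ c + (m + (k + e))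
    rearrange = ℕ-Solver.solve-∀
    K⊆R : K ⊆ R
    K⊆R x∈K = let x∈S , x∈NS = x∈p∩q⁻ S (N G S) x∈K in
      x∈p∧x∉q⇒x∈p─q x∈NS (λ x∈NC → N[core]#S S x∈NC x∈S)
    ∣K∣+∣R─S∣≤∣R∣ : ∣ K ∣ + ∣ R ─ S ∣ ≤ ∣ R ∣
    ∣K∣+∣R─S∣≤∣R∣ = disjoint⇒∣p∣+∣q∣≤∣r∣ K⊆R (p─q⊆p R S)
      (λ x∈K x∈R─S → x∈p─q⇒x∉q x∈R─S (p∩q⊆p S (N G S) x∈K))
    ∣NC∣+∣R∣≤∣NS∣ : ∣ N G C ∣ + ∣ R ∣ ≤ ∣ N G S ∣
    ∣NC∣+∣R∣≤∣NS∣ = disjoint⇒∣p∣+∣q∣≤∣r∣ (N-mono (p─q⊆p S (N G S))) (p─q⊆p (N G S) (N G C))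
      (λ x∈NC x∈R → x∈p─q⇒x∉q x∈R x∈NC)

  defect≤defect-core : ∀ S → defect G S ≤ℤ defect G (core S)
  defect≤defect-core S = Equivalence.from defect-≤⇔ (ℕ.≤-trans (ℕ.m≤m+n _ _) (core-gain S))

  defect[core]≤defect⇒N⊆N[core]∪S : ∀ S → defect G (core S) ≤ℤ defect G S → N G S ⊆ N G (core S) ∪ S
  defect[core]≤defect⇒N⊆N[core]∪S S tight {x} x∈NS with x ∈? N G (core S) | x ∈? S
  ... | yes x∈NC | _     = p⊆p∪q S x∈NC
  ... | no _     | yes x∈S = q⊆p∪q (N G (core S)) S x∈S
  ... | no x∉NC  | no x∉S  = ⊥-elim (ℕ.<⇒≱ (x∈p⇒0<∣p∣ x∈E) ∣E∣≤0)
    where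
    x∈E : x ∈ uncovered S
    x∈E = x∈p∧x∉q⇒x∈p─q (x∈p∧x∉q⇒x∈p─q x∈NS x∉NC) x∉S
    ∣E∣≤0 : ∣ uncovered S ∣ ≤ 0
    ∣E∣≤0 = ℕ.+-cancelˡ-≤ (∣ S ∣ + ∣ N G (core S) ∣) _ _ (begin
      ∣ S ∣ + ∣ N G (core S) ∣ + ∣ uncovered S ∣ ≤⟨ core-gain S ⟩
      ∣ core S ∣ + ∣ N G S ∣                    ≤⟨ Equivalence.to defect-≤⇔ tight ⟩
      ∣ S ∣ + ∣ N G (core S) ∣                  ≡⟨ ℕ.+-identityʳ _ ⟨
      ∣ S ∣ + ∣ N G (core S) ∣ + 0              ∎)
      where open ℕ.≤-Reasoning

  defect≤critical : ∀ {J} → Critical G J → ∀ S → defect G S ≤ℤ defect G J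
  defect≤critical (_ , maxJ) S = ℤ.≤-trans (defect≤defect-core S) (maxJ (core S) (core-independent S))

  defect≥critical⇒critical : ∀ {J T} → Critical G J → Independent G T → defect G J ≤ℤ defect G T → Critical G T
  defect≥critical⇒critical (_ , maxJ) indT J≤T = indT , λ K indK → ℤ.≤-trans (maxJ K indK) J≤T

  defect≥critical-∪ : ∀ {J A B} → Critical G J →
    defect G J ≤ℤ defect G A → defect G J ≤ℤ defect G B → defect G J ≤ℤ defect G (A ∪ B)
  defect≥critical-∪ {J} {A} {B} critJ J≤A J≤B = +-cancelʳ-≤ (defect G J) (begin
    defect G J +ℤ defect G J              ≤⟨ ℤ.+-mono-≤ J≤A J≤B ⟩
    defect G A +ℤ defect G B              ≤⟨ defect-supermodular A B ⟩
    defect G (A ∪ B) +ℤ defect G (A ∩ B)  ≤⟨ ℤ.+-monoʳ-≤ (defect G (A ∪ B)) (defect≤critical critJ (A ∩ B)) ⟩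
    defect G (A ∪ B) +ℤ defect G J        ∎)
    where open ℤ.≤-Reasoning

  L : Subset n → Subset n
  L J = J ∪ N G J

  ∈L⇔InL : ∀ {J v} → v ∈ L J ⇔ InL G J v
  ∈L⇔InL {J} = mk⇔ (x∈p∪q⁻ J (N G J)) x∈p∪q⁺

  module _ {J} (mcJ : MaximumCritical G J) {I} (critI : Critical G I) where
    private
      critJ = proj₁ mcJ
      indJ = proj₁ critJ
      indI = proj₁ critI
      S = I ∪ J
      C = core S
      J≤S : defect G J ≤ℤ defect G S
      J≤S = defect≥critical-∪ critJ (proj₂ critI J indJ) ℤ.≤-refl
      J≤C : defect G J ≤ℤ defect G C
      J≤C = ℤ.≤-trans J≤S (defect≤defect-core S)
      N[S]⊆N[C]∪S : N G S ⊆ N G C ∪ S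
      N[S]⊆N[C]∪S = defect[core]≤defect⇒N⊆N[core]∪S S (ℤ.≤-trans (proj₂ critJ C (core-independent S)) J≤S)

    core[I∪J]⊆J : core (I ∪ J) ⊆ J
    core[I∪J]⊆J {x} x∈C with x ∈? J
    ... | yes x∈J = x∈J
    ... | no x∉J = ⊥-elim (ℕ.<⇒≱ (p⊂q⇒∣p∣<∣q∣ J⊂C∪J) (proj₂ mcJ C∪J critC∪J))
      where
      C∪J = C ∪ J
      indC∪J : Independent G C∪J
      indC∪J = Independent-∪ (core-independent S) indJ
        (λ y∈NC y∈J → N[core]#S S y∈NC (q⊆p∪q I J y∈J))
      critC∪J : Critical G C∪J
      critC∪J = defect≥critical⇒critical critJ indC∪J (defect≥critical-∪ critJ J≤C ℤ.≤-refl)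
      J⊂C∪J : J ⊂ C∪J
      J⊂C∪J = q⊆p∪q C J , x , p⊆p∪q J x∈C , x∉J

    critical⊆L : I ⊆ L J
    critical⊆L {x} x∈I with x ∈? N G S
    ... | no x∉NS = p⊆p∪q (N G J) (core[I∪J]⊆J (x∈p∧x∉q⇒x∈p─q (p⊆p∪q J x∈I) x∉NS))
    ... | yes x∈NS with ∈N⁻ x∈NS
    ...   | w , w∈S , wx with x∈p∪q⁻ I J w∈S
    ...     | inj₁ w∈I = ⊥-elim (indI w x w∈I x∈I wx)
    ...     | inj₂ w∈J = q⊆p∪q J (N G J) (∈N⁺ w∈J wx)

    N[critical]⊆L : N G I ⊆ L J
    N[critical]⊆L {x} x∈NI =
      [ N[C]⊆L , S⊆L ]′ (x∈p∪q⁻ (N G C) S (N[S]⊆N[C]∪S (N-mono (p⊆p∪q J) x∈NI)))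
      where
      N[C]⊆L : x ∈ N G C → x ∈ L J
      N[C]⊆L x∈NC = q⊆p∪q J (N G J) (N-mono core[I∪J]⊆J x∈NC)
      S⊆L : x ∈ S → x ∈ L J
      S⊆L x∈S = [ (λ x∈I → ⊥-elim (Independent⇒Disjoint-N indI x∈I x∈NI)) , p⊆p∪q (N G J) ]′
                  (x∈p∪q⁻ I J x∈S)

  ∃-MaximumIndependent : ∃[ S ] MaximumIndependent G S
  ∃-MaximumIndependent = ∃-maximum Independent? {⊥} (λ u _ u∈⊥ _ _ → ∉⊥ u∈⊥)

  -- Criticality of I applied to its independent subset I − N(X), whose neighbourhood misses X.
  ∣S∩N[I]∣≤∣I─S∣ : ∀ {I S} → Critical G I → Independent G S → ∣ S ∩ N G I ∣ ≤ ∣ I ─ S ∣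
  ∣S∩N[I]∣≤∣I─S∣ {I} {S} (indI , maxI) indS = begin
    ∣ X ∣          ≤⟨ ℕ.+-cancelˡ-≤ ∣ I′ ∣ _ _ ∣I′∣+∣X∣≤∣I′∣+∣I∩NX∣ ⟩
    ∣ I ∩ N G X ∣  ≤⟨ p⊆q⇒∣p∣≤∣q∣ I∩NX⊆I─S ⟩
    ∣ I ─ S ∣      ∎
    where
    open ℕ.≤-Reasoning
    X = S ∩ N G I
    I′ = I ─ N G X
    ∣NI′∣+∣X∣≤∣NI∣ : ∣ N G I′ ∣ + ∣ X ∣ ≤ ∣ N G I ∣
    ∣NI′∣+∣X∣≤∣NI∣ = disjoint⇒∣p∣+∣q∣≤∣r∣ (N-mono (p─q⊆p I (N G X))) (p∩q⊆q S (N G I))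
      λ x∈NI′ x∈X → let u , u∈I′ , ux = ∈N⁻ x∈NI′ in x∈p─q⇒x∉q u∈I′ (∈N⁺ x∈X (Adj-sym ux))
    ∣I′∣+∣X∣≤∣I∣ : ∣ I′ ∣ + ∣ X ∣ ≤ ∣ I ∣
    ∣I′∣+∣X∣≤∣I∣ = ℕ.+-cancelʳ-≤ ∣ N G I′ ∣ _ _ (begin
      ∣ I′ ∣ + ∣ X ∣ + ∣ N G I′ ∣    ≡⟨ ℕ.+-assoc ∣ I′ ∣ _ _ ⟩
      ∣ I′ ∣ + (∣ X ∣ + ∣ N G I′ ∣)  ≡⟨ cong (∣ I′ ∣ +_) (ℕ.+-comm ∣ X ∣ _) ⟩
      ∣ I′ ∣ + (∣ N G I′ ∣ + ∣ X ∣)  ≤⟨ ℕ.+-monoʳ-≤ ∣ I′ ∣ ∣NI′∣+∣X∣≤∣NI∣ ⟩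
      ∣ I′ ∣ + ∣ N G I ∣             ≤⟨ Equivalence.to defect-≤⇔ (maxI I′ (Independent-⊆ (p─q⊆p I (N G X)) indI)) ⟩
      ∣ I ∣ + ∣ N G I′ ∣             ∎)
    ∣I′∣+∣X∣≤∣I′∣+∣I∩NX∣ : ∣ I′ ∣ + ∣ X ∣ ≤ ∣ I′ ∣ + ∣ I ∩ N G X ∣
    ∣I′∣+∣X∣≤∣I′∣+∣I∩NX∣ = begin
      ∣ I′ ∣ + ∣ X ∣               ≤⟨ ∣I′∣+∣X∣≤∣I∣ ⟩
      ∣ I ∣                        ≡⟨ ∣p∣≡∣p∩q∣+∣p─q∣ I (N G X) ⟩
      ∣ I ∩ N G X ∣ + ∣ I′ ∣       ≡⟨ ℕ.+-comm ∣ I ∩ N G X ∣ _ ⟩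
      ∣ I′ ∣ + ∣ I ∩ N G X ∣       ∎
    I∩NX⊆I─S : I ∩ N G X ⊆ I ─ S
    I∩NX⊆I─S x∈I∩NX = let x∈I , x∈NX = x∈p∩q⁻ I (N G X) x∈I∩NX in
      x∈p∧x∉q⇒x∈p─q x∈I (λ x∈S → Independent⇒Disjoint-N indS x∈S (N-mono (p∩q⊆p S (N G I)) x∈NX))

  critical⊆MaximumIndependent : ∀ {I} → Critical G I → ∃[ M ] (MaximumIndependent G M × I ⊆ M)
  critical⊆MaximumIndependent {I} critI@(indI , _) =
    M , (indM , λ K indK → ℕ.≤-trans (maxS K indK) ∣S∣≤∣M∣) , p⊆p∪q (S ─ N G I)
    where
    S = proj₁ ∃-MaximumIndependent
    indS = proj₁ (proj₂ ∃-MaximumIndependent)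
    maxS = proj₂ (proj₂ ∃-MaximumIndependent)
    M = I ∪ (S ─ N G I)
    indM : Independent G M
    indM = Independent-∪ indI (Independent-⊆ (p─q⊆p S (N G I)) indS)
      (λ x∈NI x∈S─NI → x∈p─q⇒x∉q x∈S─NI x∈NI)
    ∣S∣≤∣M∣ : ∣ S ∣ ≤ ∣ M ∣
    ∣S∣≤∣M∣ = begin
      ∣ S ∣                            ≡⟨ ∣p∣≡∣p∩q∣+∣p─q∣ S (N G I) ⟩
      ∣ S ∩ N G I ∣ + ∣ S ─ N G I ∣    ≤⟨ ℕ.+-monoˡ-≤ ∣ S ─ N G I ∣ (∣S∩N[I]∣≤∣I─S∣ critI indS) ⟩
      ∣ I ─ S ∣ + ∣ S ─ N G I ∣        ≤⟨ disjoint⇒∣p∣+∣q∣≤∣r∣ (λ x∈I─S → p⊆p∪q _ (p─q⊆p I S x∈I─S))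
                                            (q⊆p∪q I _) (λ x∈I─S x∈S─NI → x∈p─q⇒x∉q x∈I─S (p─q⊆p S _ x∈S─NI)) ⟩
      ∣ M ∣                            ∎
      where open ℕ.≤-Reasoning

  critical⊆corona : ∀ {I v} → Critical G I → v ∈ I → InCorona G v
  critical⊆corona critI v∈I = let M , maxM , I⊆M = critical⊆MaximumIndependent critI in M , maxM , I⊆M v∈I

  module _ {J} (critJ : Critical G J) (corona∩∂L≡∅ : ∀ v → ¬ (InCorona G v × InBoundaryL G J v))
           {S} (maxS : MaximumIndependent G S) where
    private
      indJ = proj₁ critJ
      indS = proj₁ maxS
      maximumS = proj₂ maxS
      I = S ∩ L J
      indI : Independent G I
      indI = Independent-⊆ (p∩q⊆p S (L J)) indS
      N[I]⊆L : N G I ⊆ L J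
      N[I]⊆L {x} x∈NI with ∈N⁻ x∈NI
      ... | w , w∈I , wx with x∈p∩q⁻ S (L J) w∈I
      ...   | w∈S , w∈L with x∈p∪q⁻ J (N G J) w∈L | x ∈? L J
      ...     | inj₁ w∈J  | _       = q⊆p∪q J (N G J) (∈N⁺ w∈J wx)
      ...     | inj₂ _    | yes x∈L = x∈L
      ...     | inj₂ w∈NJ | no x∉L  = ⊥-elim (corona∩∂L≡∅ w
        ((S , maxS , w∈S) , inj₂ w∈NJ , x , wx , λ x∈L → x∉L (Equivalence.from ∈L⇔InL x∈L)))
      ∣I∣+∣NI∣≤∣J∣+∣NJ∣ : ∣ I ∣ + ∣ N G I ∣ ≤ ∣ J ∣ + ∣ N G J ∣
      ∣I∣+∣NI∣≤∣J∣+∣NJ∣ = ℕ.≤-trans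
        (disjoint⇒∣p∣+∣q∣≤∣r∣ (p∩q⊆q S (L J)) N[I]⊆L (Independent⇒Disjoint-N indI))
        (∣p∪q∣≤∣p∣+∣q∣ J (N G J))
      ∣J∣≤∣I∣ : ∣ J ∣ ≤ ∣ I ∣
      ∣J∣≤∣I∣ = ℕ.+-cancelʳ-≤ ∣ S ─ L J ∣ _ _ (begin
        ∣ J ∣ + ∣ S ─ L J ∣  ≤⟨ disjoint⇒∣p∣+∣q∣≤∣r∣ (p⊆p∪q _) (q⊆p∪q J _) J#S─L ⟩
        ∣ J ∪ (S ─ L J) ∣    ≤⟨ maximumS _ (Independent-∪ indJ (Independent-⊆ (p─q⊆p S (L J)) indS) NJ#S─L) ⟩
        ∣ S ∣                ≡⟨ ∣p∣≡∣p∩q∣+∣p─q∣ S (L J) ⟩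
        ∣ I ∣ + ∣ S ─ L J ∣  ∎)
        where
        open ℕ.≤-Reasoning
        J#S─L : Disjoint J (S ─ L J)
        J#S─L x∈J x∈S─L = x∈p─q⇒x∉q x∈S─L (p⊆p∪q (N G J) x∈J)
        NJ#S─L : Disjoint (N G J) (S ─ L J)
        NJ#S─L x∈NJ x∈S─L = x∈p─q⇒x∉q x∈S─L (q⊆p∪q J (N G J) x∈NJ)
      ∣NI∣≤∣NJ∣ : ∣ N G I ∣ ≤ ∣ N G J ∣
      ∣NI∣≤∣NJ∣ = ℕ.+-cancelˡ-≤ ∣ I ∣ _ _ (ℕ.≤-trans ∣I∣+∣NI∣≤∣J∣+∣NJ∣ (ℕ.+-monoˡ-≤ ∣ N G J ∣ ∣J∣≤∣I∣))

    S∩L-critical : Critical G (S ∩ L J)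
    S∩L-critical = defect≥critical⇒critical critJ indI (minus-mono-≤ (+≤+ ∣J∣≤∣I∣) (+≤+ ∣NI∣≤∣NJ∣))

mainTheorem9 : {n : ℕ} (G : Graph n) (J : Subset n) → MaximumCritical G J →
    ((∀ v → InDiadem G v ⇔ (InCorona G v × InL G J v))
      ⇔ (∀ v → ¬ (InCorona G v × InBoundaryL G J v)))
mainTheorem9 G J mcJ = mk⇔ diadem⇒corona∩∂L≡∅ corona∩∂L≡∅⇒diadem
  where
  diadem⇒corona∩∂L≡∅ : (∀ v → InDiadem G v ⇔ (InCorona G v × InL G J v)) →
                       ∀ v → ¬ (InCorona G v × InBoundaryL G J v)
  diadem⇒corona∩∂L≡∅ diadem≡ v (v∈corona , v∈L , u , vu , u∉L) =
    let I , critI , v∈I = Equivalence.from (diadem≡ v) (v∈corona , v∈L)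
    in u∉L (Equivalence.to (∈L⇔InL G) (N[critical]⊆L G mcJ critI (∈N⁺ G v∈I vu)))
  corona∩∂L≡∅⇒diadem : (∀ v → ¬ (InCorona G v × InBoundaryL G J v)) →
                       ∀ v → InDiadem G v ⇔ (InCorona G v × InL G J v)
  corona∩∂L≡∅⇒diadem corona∩∂L≡∅ v = mk⇔
    (λ (I , critI , v∈I) →
      critical⊆corona G critI v∈I , Equivalence.to (∈L⇔InL G) (critical⊆L G mcJ critI v∈I))
    (λ ((S , maxS , v∈S) , v∈L) →
      S ∩ L G J , S∩L-critical G (proj₁ mcJ) corona∩∂L≡∅ maxS ,
      x∈p∩q⁺ (v∈S , Equivalence.from (∈L⇔InL G) v∈L))
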